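{- Let $G$ be drawn from the graph model and let $G_{\mathrm{pre}}$ be any graph that yields $G$ with nonzero probability under the adversary. Then the adversary creates no new degree-2 nodes: if a node has degree $2$ in $G$, then it has degree $2$ in $G_{\mathrm{pre}}$, with the same two neighbours.
   Context: Graph model with constants $a>b>0$, $\varepsilon=\frac{b}{a+b}$, $\delta=1$ if $\varepsilon\le\frac13$ and $\delta=(1-2\varepsilon)^2/\varepsilon^2$ otherwise: spins $\sigma_v\in\{\pm1\}$ i.i.d.\ uniform on $n$ vertices; precursor $G_{\mathrm{pre}}$ has each pair as an edge independently with probability $a/n$ (equal spins) or $b/n$ (opposite spins). The adversary, acting on $G_{\mathrm{pre}}$: mark $v$ "good" if at least 3 neighbours of $v$ in $G_{\mathrm{pre}}$ have degree $\ne2$; mark a degree-2 vertex "marked" if both neighbours are good; for each marked $v$ whose two neighbours both have spin opposite to $v$, independently with probability $\delta$ delete both edges incident to $v$. The result is $G$; markings refer to $G_{\mathrm{pre}}$. -}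

module Defs where

open import Data.Nat using (ℕ; _≤_)
open import Data.Bool using (Bool; true; false; _∧_; not)
open import Data.Bool.ListAction using () renaming (all to allL)
open import Data.Fin using (Fin)
open import Data.List using (List; length; filterᵇ)
open import Data.Nat using (_≡ᵇ_; _≤ᵇ_)
open import Relation.Binary.PropositionalEquality using (_≡_)

open import Data.List using () renaming (allFin to vertices)

record Graph (n : ℕ) : Set where
  field
    adj   : Fin n → Fin n → Bool
    sym   : ∀ u v → adj u v ≡ adj v u
    irref : ∀ v → adj v v ≡ false
open Graph public

nbrs : {n : ℕ} → (Fin n → Fin n → Bool) → Fin n → List (Fin n)
nbrs {n} A v = filterᵇ (A v) (vertices n)

deg : {n : ℕ} → (Fin n → Fin n → Bool) → Fin n → ℕ
deg A v = length (nbrs A v)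

-- Spins: true = +1, false = -1.
Spins : ℕ → Set
Spins n = Fin n → Bool

module Adversary {n : ℕ} (Gpre : Graph n) (σ : Spins n) (coin : Fin n → Bool) where
  A : Fin n → Fin n → Bool
  A = adj Gpre

  degNot2 : Fin n → Bool
  degNot2 u = not (deg A u ≡ᵇ 2)

  good : Fin n → Bool
  good v = 3 ≤ᵇ length (filterᵇ degNot2 (nbrs A v))

  marked : Fin n → Bool
  marked v = (deg A v ≡ᵇ 2) ∧ allL good (nbrs A v)

  oppNbrs : Fin n → Bool
  oppNbrs v = allL (λ u → not (σ u ≟ᵇ' σ v)) (nbrs A v)
    where
      _≟ᵇ'_ : Bool → Bool → Bool
      true  ≟ᵇ' true  = true
      false ≟ᵇ' false = true
      _     ≟ᵇ' _     = false

  -- v's edges are deleted iff v is marked, has both neighbours of opposite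
  -- spin, and the independent δ-coin for v came up "delete".
  deleted : Fin n → Bool
  deleted v = marked v ∧ oppNbrs v ∧ coin v

  adjG : Fin n → Fin n → Bool
  adjG u w = adj Gpre u w ∧ not (deleted u) ∧ not (deleted w)

-- A vertex whose edges the adversary deletes has degree 2 in G_pre and only good
-- neighbours, and a good vertex has at least 3 neighbours of degree ≠ 2. Such
-- neighbours are never deleted, so a surviving good vertex keeps degree ≥ 3 in G.
-- Hence if v has degree 2 in G, then v survives (a deleted vertex is isolated) and
-- no neighbour of v is deleted (v would be good); so v loses no edge at all.
module Submission where

open import Defs hiding (sym)
open import Data.Bool using (Bool; true; false; T; not)
open import Data.Bool.Properties using (T-∧; T-≡; ∧-identityʳ; ∧-zeroʳ)
open import Data.Empty using (⊥-elim)
open import Data.Fin using (Fin)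
open import Data.List using ([]; _∷_; length; filterᵇ; allFin)
open import Data.List.Membership.Propositional using (_∈_)
open import Data.List.Membership.Propositional.Properties using (∈-allFin; ∈-filter⁺)
open import Data.List.Properties using (filter-≐; filter-none)
open import Data.List.Relation.Binary.Sublist.Propositional using (_⊆_; []; _∷_; _∷ʳ_)
open import Data.List.Relation.Binary.Sublist.Propositional.Properties using (length-mono-≤)
open import Data.List.Relation.Unary.All using (lookup; universal)
open import Data.List.Relation.Unary.All.Properties using (all⁺)
open import Data.Nat using (ℕ; _≤_; _≡ᵇ_)
open import Data.Nat.Properties using (≡ᵇ⇒≡; ≤ᵇ⇒≤; ≤-trans; 0≢1+n; n≮n)
open import Data.Product using (_×_; _,_; proj₁; proj₂)
open import Function using (_∘_; Equivalence)
open import Relation.Binary.PropositionalEquality using (_≡_; _≗_; refl; sym; trans; subst; cong)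
open import Relation.Nullary using (¬_; yes; no)
open import Relation.Nullary.Decidable using (T?)

open Equivalence using (to)

¬T⇒≡false : ∀ {b} → ¬ T b → b ≡ false
¬T⇒≡false {false} _  = refl
¬T⇒≡false {true}  ¬t = ⊥-elim (¬t _)

module _ {A : Set} where

  filterᵇ-≗ : {p q : A → Bool} → p ≗ q → filterᵇ p ≗ filterᵇ q
  filterᵇ-≗ {p} {q} p≗q = filter-≐ (T? ∘ p) (T? ∘ q)
    ((λ {x} → subst T (p≗q x)) , (λ {x} → subst T (sym (p≗q x))))

  filterᵇ-none : {p : A → Bool} → (∀ x → p x ≡ false) → ∀ xs → filterᵇ p xs ≡ []
  filterᵇ-none {p} p≡false xs =
    filter-none (T? ∘ p) (universal (λ x → subst T (p≡false x)) xs)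

  filterᵇ-filterᵇ-⊆ : {p q r : A → Bool} → (∀ x → T (p x) → T (q x) → T (r x)) →
                      ∀ xs → filterᵇ q (filterᵇ p xs) ⊆ filterᵇ r xs
  filterᵇ-filterᵇ-⊆ pq⇒r [] = []
  filterᵇ-filterᵇ-⊆ {p} {q} {r} pq⇒r (x ∷ xs) with p x in px | r x in rx
  ... | false | true  = x ∷ʳ filterᵇ-filterᵇ-⊆ pq⇒r xs
  ... | false | false = filterᵇ-filterᵇ-⊆ pq⇒r xs
  ... | true  | true  with q x
  ...   | true  = refl ∷ filterᵇ-filterᵇ-⊆ pq⇒r xs
  ...   | false = x ∷ʳ filterᵇ-filterᵇ-⊆ pq⇒r xs
  filterᵇ-filterᵇ-⊆ {q = q} pq⇒r (x ∷ xs) | true | false with q x in qx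
  ...   | true  = ⊥-elim (subst T rx (pq⇒r x (subst T (sym px) _) (subst T (sym qx) _)))
  ...   | false = filterᵇ-filterᵇ-⊆ pq⇒r xs

module AdversaryProperties {n : ℕ} (Gpre : Graph n) (σ : Spins n) (coin : Fin n → Bool) where
  open Adversary Gpre σ coin

  ∈-nbrs : ∀ v u → T (A v u) → u ∈ nbrs A v
  ∈-nbrs v u vu = ∈-filter⁺ (T? ∘ A v) (∈-allFin u) vu

  deleted⇒marked : ∀ w → T (deleted w) → T (marked w)
  deleted⇒marked w del = proj₁ (to (T-∧ {marked w}) del)

  deleted⇒deg≡2 : ∀ w → T (deleted w) → deg A w ≡ 2
  deleted⇒deg≡2 w del = ≡ᵇ⇒≡ (deg A w) 2 (proj₁ (to (T-∧ {deg A w ≡ᵇ 2}) (deleted⇒marked w del)))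

  deleted⇒neighbour-good : ∀ u v → T (deleted u) → T (A v u) → T (good v)
  deleted⇒neighbour-good u v del vu =
    lookup (all⁺ good (nbrs A u) (proj₂ (to (T-∧ {deg A u ≡ᵇ 2}) (deleted⇒marked u del))))
           (∈-nbrs u v (subst T (Graph.sym Gpre v u) vu))

  deg≢2⇒kept : ∀ w → T (degNot2 w) → deleted w ≡ false
  deg≢2⇒kept w d≢2 = ¬T⇒≡false λ del →
    subst (λ k → T (not (k ≡ᵇ 2))) (deleted⇒deg≡2 w del) d≢2

  deleted⇒isolated : ∀ v → T (deleted v) → deg adjG v ≡ 0
  deleted⇒isolated v del rewrite to T-≡ del =
    cong length (filterᵇ-none (λ u → ∧-zeroʳ (A v u)) (allFin n))

  kept⇒adjG≡adj : ∀ v u → deleted v ≡ false → deleted u ≡ false → adjG v u ≡ A v u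
  kept⇒adjG≡adj v u v-kept u-kept rewrite v-kept | u-kept = ∧-identityʳ (A v u)

  kept-good⇒3≤deg : ∀ v → deleted v ≡ false → T (good v) → 3 ≤ deg adjG v
  kept-good⇒3≤deg v v-kept g =
    ≤-trans (≤ᵇ⇒≤ 3 _ g) (length-mono-≤ (filterᵇ-filterᵇ-⊆ keeps-edge (allFin n)))
    where
      keeps-edge : ∀ u → T (A v u) → T (degNot2 u) → T (adjG v u)
      keeps-edge u vu d≢2 = subst T (sym (kept⇒adjG≡adj v u v-kept (deg≢2⇒kept u d≢2))) vu

  neighbourhood-kept⇒adjG≡adj : ∀ v → deleted v ≡ false →
                                (∀ u → T (A v u) → deleted u ≡ false) → ∀ u → adjG v u ≡ A v u
  neighbourhood-kept⇒adjG≡adj v v-kept nbrs-kept u with T? (A v u)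
  ... | yes vu = kept⇒adjG≡adj v u v-kept (nbrs-kept u vu)
  ... | no ¬vu rewrite ¬T⇒≡false ¬vu = refl

mainTheorem7 : ∀ (n : ℕ) (Gpre : Graph n) (σ : Spins n) (coin : Fin n → Bool) (v : Fin n) →
               deg (Adversary.adjG Gpre σ coin) v ≡ 2 →
               (deg (adj Gpre) v ≡ 2) × (∀ u → Adversary.adjG Gpre σ coin v u ≡ adj Gpre v u)
mainTheorem7 n Gpre σ coin v deg≡2 =
  trans (sym (cong length (filterᵇ-≗ same-adj (allFin n)))) deg≡2 , same-adj
  where
    open Adversary Gpre σ coin
    open AdversaryProperties Gpre σ coin

    v-kept : deleted v ≡ false
    v-kept = ¬T⇒≡false λ del →
      0≢1+n (trans (sym (deleted⇒isolated v del)) deg≡2)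
    neighbours-kept : ∀ u → T (A v u) → deleted u ≡ false
    neighbours-kept u vu = ¬T⇒≡false λ del →
      n≮n 2 (subst (3 ≤_) deg≡2
        (kept-good⇒3≤deg v v-kept (deleted⇒neighbour-good u v del vu)))
    same-adj : ∀ u → adjG v u ≡ A v u
    same-adj = neighbourhood-kept⇒adjG≡adj v v-kept neighbours-kept
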